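{- Let $M$ be a matroid on a finite ground set $E$, and let $N$ be a matroid whose ground set is the set of circuits of $M$. Assume that whenever $C_1, C_2$ are circuits of $M$ with $|C_1 \cup C_2| - r_M(C_1 \cup C_2) = 2$, every circuit $C$ of $M$ with $C \subseteq C_1 \cup C_2$ satisfies $C \in \operatorname{cl}_N(\{C_1, C_2\})$. Then the function $r \colon 2^E \to \mathbb{Z}$ defined for all $X \subseteq E$ by $$r(X) = r_M(X) + r_N(\{C : C \text{ is a circuit of } M|X\})$$ is the rank function of a rank-$r(N)$ lift of $M$.
   Context: $r_M$ denotes the rank function of $M$, $\operatorname{cl}_N$ the closure operator of $N$, and $r(N)$ the rank of $N$. The circuits of $M|X$ are the circuits of $M$ contained in $X$. Given matroids $M$ and $L$ on a common ground set $E$, $L$ is a lift of $M$ if there is a matroid $K$ on a ground set $E \cup F$ (with $F$ disjoint from $E$) such that $M = K/F$ and $L = K \setminus F$; $L$ is a rank-$k$ lift of $M$ if moreover the rank of $L$ exceeds the rank of $M$ by $k$. -}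

module Defs where

open import Data.Nat using (ℕ; _+_; _∸_; _≤_; _<_)
open import Data.Bool using (Bool; true; false)
open import Data.Fin using (Fin)
open import Data.Fin.Subset using (Subset; _∈_; _⊆_; _∪_; _∩_; ∣_∣; ⁅_⁆; inside; outside; ⊤)
open import Data.Fin.Subset.Properties using (_⊆?_)
open import Data.Vec using (Vec; _++_; replicate; tabulate)
open import Data.Product using (Σ; _×_; ∃)
open import Relation.Nullary using (does)
open import Relation.Binary.PropositionalEquality using (_≡_)

record Matroid (n : ℕ) : Set where
  field
    rank       : Subset n → ℕ
    rank-≤-card : ∀ X → rank X ≤ ∣ X ∣
    rank-mono  : ∀ {X Y} → X ⊆ Y → rank X ≤ rank Y
    rank-submod : ∀ X Y → rank (X ∪ Y) + rank (X ∩ Y) ≤ rank X + rank Y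
open Matroid public

Dependent : ∀ {n} → Matroid n → Subset n → Set
Dependent M X = rank M X < ∣ X ∣

IsCircuit : ∀ {n} → Matroid n → Subset n → Set
IsCircuit M C = Dependent M C × (∀ D → D ⊆ C → Dependent M D → D ≡ C)

_∈cl_ : ∀ {m} → Fin m → (N : Matroid m) → Subset m → Set
(e ∈cl N) X = rank N (X ∪ ⁅ e ⁆) ≡ rank N X

totalRank : ∀ {n} → Matroid n → ℕ
totalRank M = rank M ⊤

record CircuitEnum {n} (M : Matroid n) (m : ℕ) : Set where
  field
    circ      : Fin m → Subset n
    circ-inj  : ∀ i j → circ i ≡ circ j → i ≡ j
    circ-isC  : ∀ i → IsCircuit M (circ i)
    circ-onto : ∀ C → IsCircuit M C → ∃ λ i → circ i ≡ C
open CircuitEnum public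

circuitsIn : ∀ {n m} {M : Matroid n} → CircuitEnum M m → Subset n → Subset m
circuitsIn ce X = tabulate (λ i → does (circ ce i ⊆? X))

-- E = Fin n sits inside E ∪ F = Fin (n + k) as the first n elements
embedE : ∀ {n} k → Subset n → Subset (n + k)
embedE k X = X ++ replicate k outside

setF : ∀ n k → Subset (n + k)
setF n k = replicate n outside ++ replicate k inside

-- L is a lift of M: some K on E ∪ F with M = K / F and L = K \ F
-- (rank of K/F on X is r_K(X ∪ F) - r_K(F); rank of K\F on X is r_K(X)).
IsLift : ∀ {n} → Matroid n → Matroid n → Set
IsLift {n} L M =
  Σ ℕ λ k → Σ (Matroid (n + k)) λ K →
    (∀ X → rank M X ≡ rank K (embedE k X ∪ setF n k) ∸ rank K (setF n k))
    × (∀ X → rank L X ≡ rank K (embedE k X))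

IsRankLift : ∀ {n} → ℕ → Matroid n → Matroid n → Set
IsRankLift j L M = IsLift L M × (totalRank L ≡ totalRank M + j)

module Submission where

-- The function r_M + ρ, where ρ(X) = r_N(circuits of M|X), is normalized, grows by at most
-- one per added element and has diminishing returns, so it is a matroid rank function. The
-- delicate case is adding some e ∈ cl_M(B) ∖ B: for a circuit d of M|(B ∪ e) through e, every
-- circuit of M|(B ∪ e) lies in cl_N(circuits of M|B ∪ {d}). Indeed the hypothesis makes every
-- N-closure a linear subclass of the circuits of M, and a linear subclass containing the
-- circuits of M|Z avoiding e and one circuit through e contains all circuits of M|Z: two
-- circuits through e either form a modular pair, and weak elimination plus linearity apply, or
-- admit an exchange reducing to smaller Z.
-- Finally, whenever r_L - r_M is monotone and bounded by k, L is a lift of M: the matroid K on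
-- E ⊔ F, |F| = k, with r_K(X ⊔ Y) = min(r_L(X) + |Y|, r_M(X) + k) has K \ F = L and K / F = M.

open import Defs
open import Data.Nat using (ℕ; suc; s≤s; _+_; _∸_; _≤_; _<_; _⊓_; _<?_) renaming (_≟_ to _≟ℕ_)
open import Data.Nat.Properties
open import Data.Nat.Tactic.RingSolver using (solve-∀)
open import Algebra.Properties.CommutativeSemigroup +-commutativeSemigroup
  using (interchange; xy∙z≈xz∙y; x∙yz≈y∙xz; x∙yz≈xz∙y)
open import Data.Bool using (_∨_; _∧_)
open import Data.Fin using (Fin) renaming (_≟_ to _≟ᶠ_)
open import Data.Fin.Properties using (any?)
open import Data.Fin.Subset
open import Data.Fin.Subset.Properties
open import Data.Fin.Subset.Induction using (⊂-wellFounded)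
open import Data.Vec using ([]; _∷_; here; there; _++_; take; drop)
open import Data.Vec.Properties
  using (lookup∘tabulate; []=⇒lookup; lookup⇒[]=; take++drop≡id; take-zipWith; drop-zipWith; zipWith-++;
         ++-injectiveˡ; ++-injectiveʳ)
open import Data.Product using (Σ; _×_; _,_; proj₁; proj₂; ∃-syntax)
open import Data.Sum using (inj₁; inj₂; [_,_])
open import Data.Empty using () renaming (⊥-elim to absurd)
open import Function using (_∘_)
open import Induction.WellFounded using (Acc; acc)
open import Relation.Nullary using (¬_; Dec; yes; no; contradiction)
open import Relation.Nullary.Decidable using (_×-dec_; ¬?; dec-true)
open import Relation.Binary.PropositionalEquality hiding ([_])

private variable
  n : ℕ
  x y : Fin n
  p q s : Subset n

-- Finite subsets

∪-lub : p ⊆ s → q ⊆ s → p ∪ q ⊆ s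
∪-lub p⊆s q⊆s = [ p⊆s , q⊆s ] ∘ x∈p∪q⁻ _ _

∪-monoˡ : p ⊆ q → p ∪ s ⊆ q ∪ s
∪-monoˡ {s = s} p⊆q = ∪-lub (p⊆p∪q s ∘ p⊆q) (q⊆p∪q _ s)

x∈p─q⇒x∉q : ∀ (p q : Subset n) → x ∈ p ─ q → x ∉ q
x∈p─q⇒x∉q (inside ∷ p) (outside ∷ q) here ()
x∈p─q⇒x∉q (_ ∷ p) (_ ∷ q) (there x∈p─q) (there x∈q) = x∈p─q⇒x∉q p q x∈p─q x∈q

x∈p-y⇒x≢y : ∀ (p : Subset n) → x ∈ p - y → x ≢ y
x∈p-y⇒x≢y {y = y} p x∈p-y refl = x∈p─q⇒x∉q p ⁅ y ⁆ x∈p-y (x∈⁅x⁆ y)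

x∉p-x : ∀ (p : Subset n) → x ∉ p - x
x∉p-x p x∈p-x = x∈p-y⇒x≢y p x∈p-x refl

p-x⊆p : ∀ (p : Subset n) → p - x ⊆ p
p-x⊆p {x = x} p = p─q⊆p p ⁅ x ⁆

p⊆q∧x∉p⇒p⊆q-x : p ⊆ q → x ∉ p → p ⊆ q - x
p⊆q∧x∉p⇒p⊆q-x {p = p} p⊆q x∉p y∈p = x∈p∧x≢y⇒x∈p-y (p⊆q y∈p) λ { refl → x∉p y∈p }

p⊆q⇒p-x⊆q-x : p ⊆ q → p - x ⊆ q - x
p⊆q⇒p-x⊆q-x {p = p} p⊆q y∈p-x = x∈p∧x≢y⇒x∈p-y (p⊆q (p-x⊆p p y∈p-x)) (x∈p-y⇒x≢y p y∈p-x)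

p∪q-x⊆p-x∪q : ∀ (p q : Subset n) → (p ∪ q) - x ⊆ (p - x) ∪ q
p∪q-x⊆p-x∪q p q y∈ with x∈p∪q⁻ p q (p-x⊆p _ y∈)
... | inj₁ y∈p = p⊆p∪q q (x∈p∧x≢y⇒x∈p-y y∈p (x∈p-y⇒x≢y _ y∈))
... | inj₂ y∈q = q⊆p∪q _ q y∈q

p∪q─q⊆p : ∀ (p q : Subset n) → (p ∪ q) ─ q ⊆ p
p∪q─q⊆p p q y∈ with x∈p∪q⁻ p q (p─q⊆p _ q y∈)
... | inj₁ y∈p = y∈p
... | inj₂ y∈q = contradiction y∈q (x∈p─q⇒x∉q _ q y∈)

x∈p∪q∧x∉q⇒x∈p : x ∈ p ∪ q → x ∉ q → x ∈ p
x∈p∪q∧x∉q⇒x∈p {p = p} {q = q} x∈p∪q x∉q =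
  [ (λ x∈p → x∈p) , (λ x∈q → contradiction x∈q x∉q) ] (x∈p∪q⁻ p q x∈p∪q)

p⊆s∧q⊆s⇒p∪q⊂s : p ⊆ s → q ⊆ s → x ∈ s → x ∉ p → x ∉ q → p ∪ q ⊂ s
p⊆s∧q⊆s⇒p∪q⊂s {p = p} {q = q} p⊆s q⊆s x∈s x∉p x∉q = ∪-lub p⊆s q⊆s , _ , x∈s , [ x∉p , x∉q ] ∘ x∈p∪q⁻ p q

∣p∪q∣+∣p∩q∣≡∣p∣+∣q∣ : ∀ (p q : Subset n) → ∣ p ∪ q ∣ + ∣ p ∩ q ∣ ≡ ∣ p ∣ + ∣ q ∣
∣p∪q∣+∣p∩q∣≡∣p∣+∣q∣ []            []            = refl
∣p∪q∣+∣p∩q∣≡∣p∣+∣q∣ (inside  ∷ p) (inside  ∷ q) =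
  cong suc (trans (+-suc _ _) (trans (cong suc (∣p∪q∣+∣p∩q∣≡∣p∣+∣q∣ p q)) (sym (+-suc _ _))))
∣p∪q∣+∣p∩q∣≡∣p∣+∣q∣ (inside  ∷ p) (outside ∷ q) = cong suc (∣p∪q∣+∣p∩q∣≡∣p∣+∣q∣ p q)
∣p∪q∣+∣p∩q∣≡∣p∣+∣q∣ (outside ∷ p) (inside  ∷ q) =
  trans (cong suc (∣p∪q∣+∣p∩q∣≡∣p∣+∣q∣ p q)) (sym (+-suc ∣ p ∣ ∣ q ∣))
∣p∪q∣+∣p∩q∣≡∣p∣+∣q∣ (outside ∷ p) (outside ∷ q) = ∣p∪q∣+∣p∩q∣≡∣p∣+∣q∣ p q

∣p∪q∣≡∣p∣+∣q∣ : ∀ {n} {p q : Subset n} → (∀ {x} → x ∈ p → x ∉ q) → ∣ p ∪ q ∣ ≡ ∣ p ∣ + ∣ q ∣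
∣p∪q∣≡∣p∣+∣q∣ {n} {p} {q} disjoint = begin
  ∣ p ∪ q ∣              ≡⟨ +-identityʳ _ ⟨
  ∣ p ∪ q ∣ + 0          ≡⟨ cong (∣ p ∪ q ∣ +_) (∣⊥∣≡0 n) ⟨
  ∣ p ∪ q ∣ + ∣ ⊥ {n} ∣  ≡⟨ cong (λ s → ∣ p ∪ q ∣ + ∣ s ∣) p∩q≡⊥ ⟨
  ∣ p ∪ q ∣ + ∣ p ∩ q ∣  ≡⟨ ∣p∪q∣+∣p∩q∣≡∣p∣+∣q∣ p q ⟩
  ∣ p ∣ + ∣ q ∣          ∎
  where
  open ≡-Reasoning
  p∩q≡⊥ : p ∩ q ≡ ⊥
  p∩q≡⊥ = Empty-unique λ (x , x∈p∩q) → let x∈p , x∈q = x∈p∩q⁻ p q x∈p∩q in disjoint x∈p x∈q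

x∈p⇒⁅x⁆⊆p : x ∈ p → ⁅ x ⁆ ⊆ p
x∈p⇒⁅x⁆⊆p {x = x} {p = p} x∈p y∈⁅x⁆ = subst (_∈ p) (sym (x∈⁅y⁆⇒x≡y x y∈⁅x⁆)) x∈p

p⊆p─q∪q : ∀ (p q : Subset n) → p ⊆ (p ─ q) ∪ q
p⊆p─q∪q p q {x} x∈p with x ∈? q
... | yes x∈q = q⊆p∪q _ q x∈q
... | no  x∉q = p⊆p∪q q (x∈p∧x∉q⇒x∈p─q x∈p x∉q)

q⊆p⇒p─q∪q≡p : q ⊆ p → (p ─ q) ∪ q ≡ p
q⊆p⇒p─q∪q≡p {q = q} {p = p} q⊆p = ⊆-antisym (∪-lub (p─q⊆p p q) q⊆p) (p⊆p─q∪q p q)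

x∈p⇒p-x∪⁅x⁆≡p : x ∈ p → (p - x) ∪ ⁅ x ⁆ ≡ p
x∈p⇒p-x∪⁅x⁆≡p = q⊆p⇒p─q∪q≡p ∘ x∈p⇒⁅x⁆⊆p

x∈p⇒p∪⁅x⁆≡p : x ∈ p → p ∪ ⁅ x ⁆ ≡ p
x∈p⇒p∪⁅x⁆≡p {p = p} x∈p = ⊆-antisym (∪-lub ⊆-refl (x∈p⇒⁅x⁆⊆p x∈p)) (p⊆p∪q _)

q⊆p⇒∣p─q∣+∣q∣≡∣p∣ : q ⊆ p → ∣ p ─ q ∣ + ∣ q ∣ ≡ ∣ p ∣
q⊆p⇒∣p─q∣+∣q∣≡∣p∣ {q = q} {p = p} q⊆p =
  trans (sym (∣p∪q∣≡∣p∣+∣q∣ (x∈p─q⇒x∉q p q))) (cong ∣_∣ (q⊆p⇒p─q∪q≡p q⊆p))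

x∈p⇒1+∣p-x∣≡∣p∣ : x ∈ p → suc ∣ p - x ∣ ≡ ∣ p ∣
x∈p⇒1+∣p-x∣≡∣p∣ {x = x} {p = p} x∈p = begin
  suc ∣ p - x ∣          ≡⟨ +-comm 1 _ ⟩
  ∣ p - x ∣ + 1          ≡⟨ cong (∣ p - x ∣ +_) (∣⁅x⁆∣≡1 x) ⟨
  ∣ p - x ∣ + ∣ ⁅ x ⁆ ∣  ≡⟨ q⊆p⇒∣p─q∣+∣q∣≡∣p∣ (x∈p⇒⁅x⁆⊆p x∈p) ⟩
  ∣ p ∣                  ∎
  where open ≡-Reasoning

x∉p⇒∣p∪⁅x⁆∣≡1+∣p∣ : x ∉ p → ∣ p ∪ ⁅ x ⁆ ∣ ≡ suc ∣ p ∣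
x∉p⇒∣p∪⁅x⁆∣≡1+∣p∣ {x = x} {p = p} x∉p = begin
  ∣ p ∪ ⁅ x ⁆ ∣      ≡⟨ ∣p∪q∣≡∣p∣+∣q∣ (λ y∈p y∈⁅x⁆ → x∉p (subst (_∈ p) (x∈⁅y⁆⇒x≡y x y∈⁅x⁆) y∈p)) ⟩
  ∣ p ∣ + ∣ ⁅ x ⁆ ∣  ≡⟨ cong (∣ p ∣ +_) (∣⁅x⁆∣≡1 x) ⟩
  ∣ p ∣ + 1          ≡⟨ +-comm _ 1 ⟩
  suc ∣ p ∣          ∎
  where open ≡-Reasoning

p⊈q⇒∃∉ : p ⊈ q → ∃[ x ] x ∈ p × x ∉ q
p⊈q⇒∃∉ {p = p} {q = q} p⊈q with any? (λ x → (x ∈? p) ×-dec ¬? (x ∈? q))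
... | yes witness = witness
... | no  none    = absurd (p⊈q λ {x} → p⊆q {x})
  where
  p⊆q : p ⊆ q
  p⊆q {x} x∈p with x ∈? q
  ... | yes x∈q = x∈q
  ... | no  x∉q = contradiction (x , x∈p , x∉q) none

∣p++q∣≡∣p∣+∣q∣ : ∀ {a b} (p : Subset a) (q : Subset b) → ∣ p ++ q ∣ ≡ ∣ p ∣ + ∣ q ∣
∣p++q∣≡∣p∣+∣q∣ []            q = refl
∣p++q∣≡∣p∣+∣q∣ (inside  ∷ p) q = cong suc (∣p++q∣≡∣p∣+∣q∣ p q)
∣p++q∣≡∣p∣+∣q∣ (outside ∷ p) q = ∣p++q∣≡∣p∣+∣q∣ p q

∣p∣≡∣take∣+∣drop∣ : ∀ a {b} (p : Subset (a + b)) → ∣ p ∣ ≡ ∣ take a p ∣ + ∣ drop a p ∣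
∣p∣≡∣take∣+∣drop∣ a p = trans (cong ∣_∣ (sym (take++drop≡id a p))) (∣p++q∣≡∣p∣+∣q∣ (take a p) (drop a p))

take-++ : ∀ {a b} (p : Subset a) (q : Subset b) → take a (p ++ q) ≡ p
take-++ {a} p q = ++-injectiveˡ (take a (p ++ q)) p (take++drop≡id a (p ++ q))

drop-++ : ∀ {a b} (p : Subset a) (q : Subset b) → drop a (p ++ q) ≡ q
drop-++ {a} p q = ++-injectiveʳ (take a (p ++ q)) p (take++drop≡id a (p ++ q))

p⊆q⇒p∪q≡q : p ⊆ q → p ∪ q ≡ q
p⊆q⇒p∪q≡q {p = p} {q = q} p⊆q = ⊆-antisym (∪-lub p⊆q ⊆-refl) (q⊆p∪q p q)

p∪q≡q⇒p⊆q : p ∪ q ≡ q → p ⊆ q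
p∪q≡q⇒p⊆q {q = q} p∪q≡q x∈p = subst (_ ∈_) p∪q≡q (p⊆p∪q q x∈p)

take-⊆ : ∀ a {b} {p q : Subset (a + b)} → p ⊆ q → take a p ⊆ take a q
take-⊆ a {p = p} {q} p⊆q = p∪q≡q⇒p⊆q (trans (sym (take-zipWith _∨_ p q)) (cong (take a) (p⊆q⇒p∪q≡q p⊆q)))

drop-⊆ : ∀ a {b} {p q : Subset (a + b)} → p ⊆ q → drop a p ⊆ drop a q
drop-⊆ a {p = p} {q} p⊆q = p∪q≡q⇒p⊆q (trans (sym (drop-zipWith _∨_ p q)) (cong (drop a) (p⊆q⇒p∪q≡q p⊆q)))

subset-induction : (P : Subset n → Set) → P ⊥ → ∀ s →
  (∀ p x → p ⊆ s → x ∈ s → x ∉ p → P p → P (p ∪ ⁅ x ⁆)) → P s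
subset-induction P P⊥ s = go s (⊂-wellFounded s)
  where
  go : ∀ s → Acc _⊂_ s → (∀ p x → p ⊆ s → x ∈ s → x ∉ p → P p → P (p ∪ ⁅ x ⁆)) → P s
  go s (acc rec) step with nonempty? s
  ... | no  s-empty     = subst P (sym (Empty-unique s-empty)) P⊥
  ... | yes (x , x∈s) = subst P (x∈p⇒p-x∪⁅x⁆≡p x∈s)
    (step (s - x) x (p-x⊆p s) x∈s (x∉p-x s)
      (go (s - x) (rec (x∈p⇒p-x⊂p x∈s))
        λ p y p⊆s-x y∈s-x → step p y (p-x⊆p s ∘ p⊆s-x) (p-x⊆p s y∈s-x)))

minimal : (P : Subset n → Set) → (∀ s → Dec (P s)) → P s →
  ∃[ t ] t ⊆ s × P t × (∀ {x} → x ∈ t → ¬ P (t - x))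
minimal {s = s} P P? = go s (⊂-wellFounded s)
  where
  go : ∀ s → Acc _⊂_ s → P s → ∃[ t ] t ⊆ s × P t × (∀ {x} → x ∈ t → ¬ P (t - x))
  go s (acc rec) Ps with any? (λ x → (x ∈? s) ×-dec P? (s - x))
  ... | no  none                 = s , ⊆-refl , Ps , λ x∈s Ps-x → none (_ , x∈s , Ps-x)
  ... | yes (x , x∈s , Ps-x) =
    let t , t⊆s-x , Pt , min = go (s - x) (rec (x∈p⇒p-x⊂p x∈s)) Ps-x
    in  t , p-x⊆p s ∘ t⊆s-x , Pt , min

-- Submodular set functions

+-≤-telescope : ∀ {a b c d e f} → a + b ≤ c + d → d + e ≤ f + b → a + e ≤ f + c
+-≤-telescope {a} {b} {c} {d} {e} {f} ab≤cd de≤fb = +-cancelʳ-≤ (b + d) _ _ (begin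
  a + e + (b + d)      ≡⟨ regroupˡ a b d e ⟩
  (a + b) + (d + e)    ≤⟨ +-mono-≤ ab≤cd de≤fb ⟩
  (c + d) + (f + b)    ≡⟨ regroupʳ c d f b ⟩
  f + c + (b + d)      ∎)
  where
  open ≤-Reasoning
  regroupˡ : ∀ a b d e → a + e + (b + d) ≡ (a + b) + (d + e)
  regroupˡ = solve-∀
  regroupʳ : ∀ c d f b → (c + d) + (f + b) ≡ f + c + (b + d)
  regroupʳ = solve-∀

+-≤-slack : ∀ {a b c d k} → a + k ≤ b → c ≤ d + k → a + c ≤ b + d
+-≤-slack {a} {b} {c} {d} {k} a+k≤b c≤d+k = begin
  a + c        ≤⟨ +-monoʳ-≤ a c≤d+k ⟩
  a + (d + k)  ≡⟨ x∙yz≈xz∙y a d k ⟩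
  a + k + d    ≤⟨ +-monoˡ-≤ d a+k≤b ⟩
  b + d        ∎
  where open ≤-Reasoning

Submodular : (Subset n → ℕ) → Set
Submodular f = ∀ S T → f (S ∪ T) + f (S ∩ T) ≤ f S + f T

∣∣-submodular : Submodular (∣_∣ {n})
∣∣-submodular S T = ≤-reflexive (∣p∪q∣+∣p∩q∣≡∣p∣+∣q∣ S T)

+-submodular : ∀ {f g : Subset n → ℕ} → Submodular f → Submodular g → Submodular (λ S → f S + g S)
+-submodular {f = f} {g} f-sub g-sub S T = begin
  f (S ∪ T) + g (S ∪ T) + (f (S ∩ T) + g (S ∩ T))  ≡⟨ interchange (f (S ∪ T)) _ _ _ ⟩
  f (S ∪ T) + f (S ∩ T) + (g (S ∪ T) + g (S ∩ T))  ≤⟨ +-mono-≤ (f-sub S T) (g-sub S T) ⟩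
  f S + f T + (g S + g T)                          ≡⟨ interchange (f S) _ _ _ ⟩
  f S + g S + (f T + g T)                          ∎
  where open ≤-Reasoning

take-submodular : ∀ a {b} {f : Subset a → ℕ} → Submodular f → Submodular (λ (S : Subset (a + b)) → f (take a S))
take-submodular a {f = f} f-sub S T = subst₂ (λ U I → f U + f I ≤ f (take a S) + f (take a T))
  (sym (take-zipWith _∨_ S T)) (sym (take-zipWith _∧_ S T)) (f-sub (take a S) (take a T))

drop-submodular : ∀ a {b} {f : Subset b → ℕ} → Submodular f → Submodular (λ (S : Subset (a + b)) → f (drop a S))
drop-submodular a {f = f} f-sub S T = subst₂ (λ U I → f U + f I ≤ f (drop a S) + f (drop a T))
  (sym (drop-zipWith _∨_ S T)) (sym (drop-zipWith _∧_ S T)) (f-sub (drop a S) (drop a T))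

⊓+⊓-≤ : ∀ fU gU fI gI fS gS fT gT → fU + fI ≤ fS + fT → gU + gI ≤ gS + gT →
  fI + gS ≤ fS + gI → fI + gT ≤ fT + gI → fU ⊓ gU + fI ⊓ gI ≤ fS ⊓ gS + fT ⊓ gT
⊓+⊓-≤ fU gU fI gI fS gS fT gT f-sub g-sub crossˢ crossᵗ with ≤-total fS gS | ≤-total fT gT
... | inj₁ fS≤gS | inj₁ fT≤gT = begin
  fU ⊓ gU + fI ⊓ gI  ≤⟨ +-mono-≤ (m⊓n≤m fU gU) (m⊓n≤m fI gI) ⟩
  fU + fI            ≤⟨ f-sub ⟩
  fS + fT            ≡⟨ cong₂ _+_ (m≤n⇒m⊓n≡m fS≤gS) (m≤n⇒m⊓n≡m fT≤gT) ⟨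
  fS ⊓ gS + fT ⊓ gT  ∎
  where open ≤-Reasoning
... | inj₂ gS≤fS | inj₂ gT≤fT = begin
  fU ⊓ gU + fI ⊓ gI  ≤⟨ +-mono-≤ (m⊓n≤n fU gU) (m⊓n≤n fI gI) ⟩
  gU + gI            ≤⟨ g-sub ⟩
  gS + gT            ≡⟨ cong₂ _+_ (m≥n⇒m⊓n≡n gS≤fS) (m≥n⇒m⊓n≡n gT≤fT) ⟨
  fS ⊓ gS + fT ⊓ gT  ∎
  where open ≤-Reasoning
... | inj₁ fS≤gS | inj₂ gT≤fT = begin
  fU ⊓ gU + fI ⊓ gI  ≤⟨ +-mono-≤ (m⊓n≤n fU gU) (m⊓n≤m fI gI) ⟩
  gU + fI            ≤⟨ +-≤-telescope {gU} {gI} {gT} {gS} {fI} {fS}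
                          (≤-trans g-sub (≤-reflexive (+-comm gS gT)))
                          (≤-trans (≤-reflexive (+-comm gS fI)) crossˢ) ⟩
  fS + gT            ≡⟨ cong₂ _+_ (m≤n⇒m⊓n≡m fS≤gS) (m≥n⇒m⊓n≡n gT≤fT) ⟨
  fS ⊓ gS + fT ⊓ gT  ∎
  where open ≤-Reasoning
... | inj₂ gS≤fS | inj₁ fT≤gT = begin
  fU ⊓ gU + fI ⊓ gI  ≤⟨ +-mono-≤ (m⊓n≤n fU gU) (m⊓n≤m fI gI) ⟩
  gU + fI            ≤⟨ +-≤-telescope {gU} {gI} {gS} {gT} {fI} {fT}
                          g-sub (≤-trans (≤-reflexive (+-comm gT fI)) crossᵗ) ⟩
  fT + gS            ≡⟨ +-comm fT gS ⟩
  gS + fT            ≡⟨ cong₂ _+_ (m≥n⇒m⊓n≡n gS≤fS) (m≤n⇒m⊓n≡m fT≤gT) ⟨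
  fS ⊓ gS + fT ⊓ gT  ∎
  where open ≤-Reasoning

⊓-submodular : ∀ {f g : Subset n → ℕ} → Submodular f → Submodular g →
  (∀ {S T} → S ⊆ T → f S + g T ≤ f T + g S) → Submodular (λ S → f S ⊓ g S)
⊓-submodular {f = f} {g} f-sub g-sub crossing S T =
  ⊓+⊓-≤ (f (S ∪ T)) (g (S ∪ T)) (f (S ∩ T)) (g (S ∩ T)) (f S) (g S) (f T) (g T)
    (f-sub S T) (g-sub S T) (crossing (p∩q⊆p S T)) (crossing (p∩q⊆q S T))

DiminishingReturns : (Subset n → ℕ) → Set
DiminishingReturns f = ∀ {A B} x → A ⊆ B → f (B ∪ ⁅ x ⁆) + f A ≤ f (A ∪ ⁅ x ⁆) + f B

diminishing-returns⇒submodular : ∀ (f : Subset n → ℕ) → DiminishingReturns f → Submodular f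
diminishing-returns⇒submodular f dr S T =
  subst (λ U → f (S ∪ T) + f (S ∩ T) ≤ f S + f U) S∩T∪T≡T
    (subset-induction (λ U → f (S ∪ U) + f (S ∩ T) ≤ f S + f ((S ∩ T) ∪ U)) base T step)
  where
  base : f (S ∪ ⊥) + f (S ∩ T) ≤ f S + f ((S ∩ T) ∪ ⊥)
  base = ≤-reflexive (cong₂ _+_ (cong f (∪-identityʳ S)) (cong f (sym (∪-identityʳ (S ∩ T)))))
  step : ∀ U x → U ⊆ T → x ∈ T → x ∉ U →
    f (S ∪ U) + f (S ∩ T) ≤ f S + f ((S ∩ T) ∪ U) →
    f (S ∪ (U ∪ ⁅ x ⁆)) + f (S ∩ T) ≤ f S + f ((S ∩ T) ∪ (U ∪ ⁅ x ⁆))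
  step U x _ _ _ ih = subst₂ (λ V W → f V + f (S ∩ T) ≤ f S + f W) (∪-assoc S U ⁅ x ⁆) (∪-assoc (S ∩ T) U ⁅ x ⁆)
    (+-≤-telescope {f (S∪U ∪ ⁅ x ⁆)} {f S∩T∪U} {f (S∩T∪U ∪ ⁅ x ⁆)} {f S∪U} {f (S ∩ T)} {f S}
      (dr x (∪-monoˡ (p∩q⊆p S T))) ih)
    where
    S∪U S∩T∪U : Subset _
    S∪U = S ∪ U
    S∩T∪U = (S ∩ T) ∪ U
  S∩T∪T≡T : (S ∩ T) ∪ T ≡ T
  S∩T∪T≡T = ⊆-antisym (∪-lub (p∩q⊆q S T) ⊆-refl) (q⊆p∪q _ T)

unit-increase⇒≤∣∣ : ∀ (f : Subset n → ℕ) → f ⊥ ≡ 0 → (∀ X x → f (X ∪ ⁅ x ⁆) ≤ suc (f X)) →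
  ∀ X → f X ≤ ∣ X ∣
unit-increase⇒≤∣∣ {n} f f⊥≡0 unit X = subset-induction (λ U → f U ≤ ∣ U ∣)
  (≤-reflexive (trans f⊥≡0 (sym (∣⊥∣≡0 n)))) X
  λ U x _ _ x∉U fU≤∣U∣ → ≤-trans (unit U x) (≤-trans (s≤s fU≤∣U∣) (≤-reflexive (sym (x∉p⇒∣p∪⁅x⁆∣≡1+∣p∣ x∉U))))

-- Matroids

Independent : Matroid n → Subset n → Set
Independent M X = ∣ X ∣ ≤ rank M X

module MatroidProperties {n} (M : Matroid n) where

  private
    r : Subset n → ℕ
    r = rank M

    variable
      A B C D T : Subset n
      e : Fin n

  dependent? : ∀ X → Dec (Dependent M X)
  dependent? X = r X <? ∣ X ∣

  _∈cl?_ : ∀ x X → Dec ((x ∈cl M) X)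
  x ∈cl? X = r (X ∪ ⁅ x ⁆) ≟ℕ r X

  rank-⊥ : r ⊥ ≡ 0
  rank-⊥ = n≤0⇒n≡0 (≤-trans (rank-≤-card M ⊥) (≤-reflexive (∣⊥∣≡0 n)))

  rank-∪-≤ : ∀ A B → r (A ∪ B) ≤ r A + r B
  rank-∪-≤ A B = ≤-trans (m≤m+n _ _) (rank-submod M A B)

  rank-insert-≤ : ∀ A x → r (A ∪ ⁅ x ⁆) ≤ suc (r A)
  rank-insert-≤ A x = begin
    r (A ∪ ⁅ x ⁆)  ≤⟨ rank-∪-≤ A ⁅ x ⁆ ⟩
    r A + r ⁅ x ⁆  ≤⟨ +-monoʳ-≤ (r A) (≤-trans (rank-≤-card M ⁅ x ⁆) (≤-reflexive (∣⁅x⁆∣≡1 x))) ⟩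
    r A + 1        ≡⟨ +-comm (r A) 1 ⟩
    suc (r A)      ∎
    where open ≤-Reasoning

  nullity-mono : A ⊆ B → r B + ∣ A ∣ ≤ r A + ∣ B ∣
  nullity-mono {A} {B} A⊆B = begin
    r B + ∣ A ∣                ≤⟨ +-monoˡ-≤ ∣ A ∣ (rank-mono M (p⊆p─q∪q B A)) ⟩
    r ((B ─ A) ∪ A) + ∣ A ∣    ≤⟨ +-monoˡ-≤ ∣ A ∣ (rank-∪-≤ (B ─ A) A) ⟩
    r (B ─ A) + r A + ∣ A ∣    ≤⟨ +-monoˡ-≤ ∣ A ∣ (+-monoˡ-≤ (r A) (rank-≤-card M (B ─ A))) ⟩
    ∣ B ─ A ∣ + r A + ∣ A ∣    ≡⟨ cong (_+ ∣ A ∣) (+-comm ∣ B ─ A ∣ (r A)) ⟩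
    r A + ∣ B ─ A ∣ + ∣ A ∣    ≡⟨ +-assoc (r A) _ _ ⟩
    r A + (∣ B ─ A ∣ + ∣ A ∣)  ≡⟨ cong (r A +_) (q⊆p⇒∣p─q∣+∣q∣≡∣p∣ A⊆B) ⟩
    r A + ∣ B ∣                ∎
    where open ≤-Reasoning

  independent-⊆ : A ⊆ B → Independent M B → Independent M A
  independent-⊆ {A} {B} A⊆B indB = +-cancelˡ-≤ (r B) _ _ (begin
    r B + ∣ A ∣  ≤⟨ nullity-mono A⊆B ⟩
    r A + ∣ B ∣  ≤⟨ +-monoʳ-≤ (r A) indB ⟩
    r A + r B    ≡⟨ +-comm (r A) (r B) ⟩
    r B + r A    ∎)
    where open ≤-Reasoning

  dependent-⊇ : A ⊆ B → Dependent M A → Dependent M B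
  dependent-⊇ {A} {B} A⊆B depA = +-cancelʳ-≤ (r A) _ _ (begin
    suc (r B) + r A  ≡⟨ +-suc (r B) (r A) ⟨
    r B + suc (r A)  ≤⟨ +-monoʳ-≤ (r B) depA ⟩
    r B + ∣ A ∣      ≤⟨ nullity-mono A⊆B ⟩
    r A + ∣ B ∣      ≡⟨ +-comm (r A) ∣ B ∣ ⟩
    ∣ B ∣ + r A      ∎)
    where open ≤-Reasoning

  rank-diminishing-returns : DiminishingReturns r
  rank-diminishing-returns {A} {B} x A⊆B = begin
    r (B ∪ ⁅ x ⁆) + r A                        ≤⟨ +-mono-≤ (rank-mono M B∪x⊆) (rank-mono M A⊆) ⟩
    r ((A ∪ ⁅ x ⁆) ∪ B) + r ((A ∪ ⁅ x ⁆) ∩ B)  ≤⟨ rank-submod M (A ∪ ⁅ x ⁆) B ⟩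
    r (A ∪ ⁅ x ⁆) + r B                        ∎
    where
    open ≤-Reasoning
    B∪x⊆ : B ∪ ⁅ x ⁆ ⊆ (A ∪ ⁅ x ⁆) ∪ B
    B∪x⊆ = ∪-lub (q⊆p∪q _ B) (p⊆p∪q B ∘ q⊆p∪q A ⁅ x ⁆)
    A⊆ : A ⊆ (A ∪ ⁅ x ⁆) ∩ B
    A⊆ a = x∈p∩q⁺ (p⊆p∪q _ a , A⊆B a)

  ∉cl⇒rank-insert≡1+ : ¬ (x ∈cl M) A → r (A ∪ ⁅ x ⁆) ≡ suc (r A)
  ∉cl⇒rank-insert≡1+ {x} {A} x∉clA =
    ≤-antisym (rank-insert-≤ A x) (≤∧≢⇒< (rank-mono M (p⊆p∪q _)) (x∉clA ∘ sym))

  ∈cl-∈ : x ∈ A → (x ∈cl M) A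
  ∈cl-∈ x∈A = cong r (x∈p⇒p∪⁅x⁆≡p x∈A)

  ∈cl-mono : A ⊆ B → (x ∈cl M) A → (x ∈cl M) B
  ∈cl-mono {A} {B} {x} A⊆B x∈clA = ≤-antisym (+-cancelʳ-≤ (r A) _ _ (begin
    r (B ∪ ⁅ x ⁆) + r A  ≤⟨ rank-diminishing-returns x A⊆B ⟩
    r (A ∪ ⁅ x ⁆) + r B  ≡⟨ cong (_+ r B) x∈clA ⟩
    r A + r B            ≡⟨ +-comm (r A) (r B) ⟩
    r B + r A            ∎)) (rank-mono M (p⊆p∪q _))
    where open ≤-Reasoning

  ∈cl-of-≡-rank : A ⊆ B → r A ≡ r B → (x ∈cl M) B → (x ∈cl M) A
  ∈cl-of-≡-rank {A} {B} {x} A⊆B rA≡rB x∈clB = ≤-antisym (begin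
    r (A ∪ ⁅ x ⁆)  ≤⟨ rank-mono M (∪-monoˡ A⊆B) ⟩
    r (B ∪ ⁅ x ⁆)  ≡⟨ x∈clB ⟩
    r B            ≡⟨ rA≡rB ⟨
    r A            ∎) (rank-mono M (p⊆p∪q _))
    where open ≤-Reasoning

  rank-∪-spanned : (∀ {y} → y ∈ A → (y ∈cl M) B) → r (B ∪ A) ≡ r B
  rank-∪-spanned {A} {B} spanned = subset-induction (λ U → r (B ∪ U) ≡ r B) (cong r (∪-identityʳ B)) A
    λ U y _ y∈A _ r[B∪U]≡rB → trans (cong r (sym (∪-assoc B U ⁅ y ⁆)))
                                    (trans (∈cl-mono (p⊆p∪q U) (spanned y∈A)) r[B∪U]≡rB)

  ∈cl-trans : (∀ {y} → y ∈ A → (y ∈cl M) B) → (x ∈cl M) A → (x ∈cl M) B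
  ∈cl-trans {A} {B} {x} spanned x∈clA = ≤-antisym (begin
    r (B ∪ ⁅ x ⁆)        ≤⟨ rank-mono M (∪-monoˡ (p⊆p∪q A)) ⟩
    r ((B ∪ A) ∪ ⁅ x ⁆)  ≡⟨ ∈cl-mono (q⊆p∪q B A) x∈clA ⟩
    r (B ∪ A)            ≡⟨ rank-∪-spanned spanned ⟩
    r B                  ∎) (rank-mono M (p⊆p∪q _))
    where open ≤-Reasoning

  independent-∪-∉ : Independent M A → x ∉ A → suc (r A) ≤ r (A ∪ ⁅ x ⁆) → Independent M (A ∪ ⁅ x ⁆)
  independent-∪-∉ {A} {x} indA x∉A rank-grows = begin
    ∣ A ∪ ⁅ x ⁆ ∣  ≡⟨ x∉p⇒∣p∪⁅x⁆∣≡1+∣p∣ x∉A ⟩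
    suc ∣ A ∣      ≤⟨ s≤s indA ⟩
    suc (r A)      ≤⟨ rank-grows ⟩
    r (A ∪ ⁅ x ⁆)  ∎
    where open ≤-Reasoning

  independent∧dependent-∪⇒∈cl : Independent M A → x ∉ A → Dependent M (A ∪ ⁅ x ⁆) → (x ∈cl M) A
  independent∧dependent-∪⇒∈cl {A} {x} indA x∉A dep = ≤-antisym (begin
    r (A ∪ ⁅ x ⁆)  ≤⟨ ≤-pred (≤-trans dep (≤-reflexive (x∉p⇒∣p∪⁅x⁆∣≡1+∣p∣ x∉A))) ⟩
    ∣ A ∣          ≤⟨ indA ⟩
    r A            ∎) (rank-mono M (p⊆p∪q _))
    where open ≤-Reasoning

  circuit-nonempty : IsCircuit M C → Nonempty C
  circuit-nonempty {C} (depC , _) with nonempty? C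
  ... | yes x∈C  = x∈C
  ... | no  C≡∅ = contradiction (subst (λ c → r c < ∣ c ∣) (Empty-unique C≡∅) depC)
                                λ depC∅ → n≮0 (≤-trans depC∅ (≤-reflexive (∣⊥∣≡0 n)))

  circuit-minus-independent : IsCircuit M C → x ∈ C → Independent M (C - x)
  circuit-minus-independent {C} {x} (_ , minimal) x∈C = ≮⇒≥ λ depC-x →
    x∉p-x C (subst (x ∈_) (sym (minimal (C - x) (p-x⊆p C) depC-x)) x∈C)

  circuit-∈cl : IsCircuit M C → x ∈ C → (x ∈cl M) (C - x)
  circuit-∈cl {C} isC x∈C = independent∧dependent-∪⇒∈cl (circuit-minus-independent isC x∈C) (x∉p-x C)
    (subst (Dependent M) (sym (x∈p⇒p-x∪⁅x⁆≡p x∈C)) (proj₁ isC))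

  circuit-rank-delete : ∀ {Y} {x : Fin n} → IsCircuit M C → C ⊆ Y → x ∈ C → r (Y - x) ≡ r Y
  circuit-rank-delete {Y = Y} {x = x} isC C⊆Y x∈C = begin
    r (Y - x)              ≡⟨ ∈cl-mono (p⊆q⇒p-x⊆q-x C⊆Y) (circuit-∈cl isC x∈C) ⟨
    r ((Y - x) ∪ ⁅ x ⁆)  ≡⟨ cong r (x∈p⇒p-x∪⁅x⁆≡p (C⊆Y x∈C)) ⟩
    r Y                    ∎
    where open ≡-Reasoning

  minimally-dependent⇒circuit : Dependent M T → (∀ {x} → x ∈ T → ¬ Dependent M (T - x)) → IsCircuit M T
  minimally-dependent⇒circuit {T} depT minimal = depT , minimum
    where
    minimum : ∀ D → D ⊆ T → Dependent M D → D ≡ T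
    minimum D D⊆T depD with T ⊆? D
    ... | yes T⊆D = ⊆-antisym D⊆T T⊆D
    ... | no  T⊈D = let x , x∈T , x∉D = p⊈q⇒∃∉ T⊈D
                    in  contradiction (dependent-⊇ (p⊆q∧x∉p⇒p⊆q-x D⊆T x∉D) depD) (minimal x∈T)

  dependent⇒circuit : Dependent M A → ∃[ C ] C ⊆ A × IsCircuit M C
  dependent⇒circuit depA =
    let C , C⊆A , depC , minimal′ = minimal (Dependent M) dependent? depA
    in  C , C⊆A , minimally-dependent⇒circuit depC minimal′

  ∈cl⇒circuit : ∀ {e W} → e ∉ W → (e ∈cl M) W → ∃[ C ] C ⊆ W ∪ ⁅ e ⁆ × IsCircuit M C × e ∈ C
  ∈cl⇒circuit {e} {W} e∉W e∈clW with minimal (λ X → (e ∈cl M) X) (e ∈cl?_) e∈clW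
  ... | T , T⊆W , e∈clT , T-minimal =
    T ∪ ⁅ e ⁆ , ∪-monoˡ T⊆W , minimally-dependent⇒circuit T∪e-dependent deletions-independent ,
    q⊆p∪q T ⁅ e ⁆ (x∈⁅x⁆ e)
    where
    e∉T : e ∉ T
    e∉T = e∉W ∘ T⊆W

    T-independent : Independent M T
    T-independent with dependent? T
    ... | no  ¬depT = ≮⇒≥ ¬depT
    ... | yes depT  =
      let C , C⊆T , isC = dependent⇒circuit depT
          x , x∈C      = circuit-nonempty isC
      in  contradiction (∈cl-of-≡-rank (p-x⊆p T) (circuit-rank-delete isC C⊆T x∈C) e∈clT)
                        (T-minimal (C⊆T x∈C))

    T∪e-dependent : Dependent M (T ∪ ⁅ e ⁆)
    T∪e-dependent = begin-strict
      r (T ∪ ⁅ e ⁆)  ≡⟨ e∈clT ⟩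
      r T            ≤⟨ rank-≤-card M T ⟩
      ∣ T ∣          <⟨ n<1+n _ ⟩
      suc ∣ T ∣      ≡⟨ x∉p⇒∣p∪⁅x⁆∣≡1+∣p∣ e∉T ⟨
      ∣ T ∪ ⁅ e ⁆ ∣  ∎
      where open ≤-Reasoning

    deletions-independent : ∀ {x} → x ∈ T ∪ ⁅ e ⁆ → ¬ Dependent M ((T ∪ ⁅ e ⁆) - x)
    deletions-independent {x} x∈T∪e dep with x ≟ᶠ e
    ... | yes refl = <⇒≱ dep (independent-⊆ (p∪q─q⊆p T ⁅ e ⁆) T-independent)
    ... | no  x≢e  = T-minimal (x∈p∪q∧x∉q⇒x∈p x∈T∪e (x≢y⇒x∉⁅y⁆ x≢e))
      (independent∧dependent-∪⇒∈cl (independent-⊆ (p-x⊆p T) T-independent) (e∉T ∘ p-x⊆p T)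
        (dependent-⊇ (p∪q-x⊆p-x∪q T ⁅ e ⁆) dep))

  distinct-circuits-nullity : IsCircuit M C → IsCircuit M D → C ≢ D → r (C ∪ D) + 2 ≤ ∣ C ∪ D ∣
  distinct-circuits-nullity {C} {D} (depC , C-minimal) (depD , D-minimal) C≢D =
    +-cancelʳ-≤ (r (C ∩ D)) _ _ (begin
      r (C ∪ D) + 2 + r (C ∩ D)  ≡⟨ xy∙z≈xz∙y (r (C ∪ D)) 2 (r (C ∩ D)) ⟩
      r (C ∪ D) + r (C ∩ D) + 2  ≤⟨ +-monoˡ-≤ 2 (rank-submod M C D) ⟩
      r C + r D + 2              ≡⟨ two-sucs (r C) (r D) ⟩
      suc (r C) + suc (r D)      ≤⟨ +-mono-≤ depC depD ⟩
      ∣ C ∣ + ∣ D ∣              ≡⟨ ∣p∪q∣+∣p∩q∣≡∣p∣+∣q∣ C D ⟨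
      ∣ C ∪ D ∣ + ∣ C ∩ D ∣      ≤⟨ +-monoʳ-≤ ∣ C ∪ D ∣ C∩D-independent ⟩
      ∣ C ∪ D ∣ + r (C ∩ D)      ∎)
    where
    open ≤-Reasoning
    two-sucs : ∀ a b → a + b + 2 ≡ suc a + suc b
    two-sucs = solve-∀
    C∩D-independent : Independent M (C ∩ D)
    C∩D-independent = ≮⇒≥ λ depC∩D →
      let C∩D≡C = C-minimal (C ∩ D) (p∩q⊆p C D) depC∩D
      in  C≢D (D-minimal C (λ x∈C → p∩q⊆q C D (subst (_ ∈_) (sym C∩D≡C) x∈C)) depC)

  weak-circuit-elimination : IsCircuit M C → IsCircuit M D → C ≢ D → e ∈ C → Dependent M ((C ∪ D) - e)
  weak-circuit-elimination {C} {D} {e} isC isD C≢D e∈C = ≤-pred (begin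
    suc (suc (r ((C ∪ D) - e)))  ≤⟨ s≤s (s≤s (rank-mono M (p-x⊆p (C ∪ D)))) ⟩
    suc (suc (r (C ∪ D)))        ≡⟨ +-comm 2 (r (C ∪ D)) ⟩
    r (C ∪ D) + 2                ≤⟨ distinct-circuits-nullity isC isD C≢D ⟩
    ∣ C ∪ D ∣                    ≡⟨ x∈p⇒1+∣p-x∣≡∣p∣ (p⊆p∪q D e∈C) ⟨
    suc ∣ (C ∪ D) - e ∣          ∎)
    where open ≤-Reasoning

  coloop-∪ : ∀ {Y A : Subset n} {e} → r (Y - e) < r Y → A ⊆ Y - e → suc (r A) ≤ r (A ∪ ⁅ e ⁆)
  coloop-∪ {Y} {A} {e} coloop A⊆Y-e = +-cancelʳ-≤ (r (Y - e)) _ _ (begin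
    suc (r A) + r (Y - e)      ≡⟨ +-suc (r A) _ ⟨
    r A + suc (r (Y - e))      ≤⟨ +-monoʳ-≤ (r A) coloop ⟩
    r A + r Y                  ≡⟨ +-comm (r A) (r Y) ⟩
    r Y + r A                  ≤⟨ +-monoˡ-≤ (r A) (rank-mono M (p⊆p─q∪q Y ⁅ e ⁆)) ⟩
    r ((Y - e) ∪ ⁅ e ⁆) + r A  ≤⟨ rank-diminishing-returns e A⊆Y-e ⟩
    r (A ∪ ⁅ e ⁆) + r (Y - e)  ∎)
    where open ≤-Reasoning

  independent-by-coloops : ∀ {P Y} → P ⊆ Y → (∀ {y} → y ∈ P → r (Y - y) < r Y) →
    Independent M (Y ─ P) → Independent M Y
  independent-by-coloops {P} {Y} P⊆Y coloops indep = subst (Independent M) (q⊆p⇒p─q∪q≡p P⊆Y)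
    (subset-induction (λ U → Independent M ((Y ─ P) ∪ U))
      (subst (Independent M) (sym (∪-identityʳ _)) indep) P step)
    where
    step : ∀ U y → U ⊆ P → y ∈ P → y ∉ U → Independent M ((Y ─ P) ∪ U) →
      Independent M ((Y ─ P) ∪ (U ∪ ⁅ y ⁆))
    step U y U⊆P y∈P y∉U indep′ = subst (Independent M) (∪-assoc (Y ─ P) U ⁅ y ⁆)
      (independent-∪-∉ indep′ y∉ (coloop-∪ (coloops y∈P) (p⊆q∧x∉p⇒p⊆q-x (∪-lub (p─q⊆p Y P) (P⊆Y ∘ U⊆P)) y∉)))
      where
      y∉ : y ∉ (Y ─ P) ∪ U
      y∉ = [ (λ y∈Y─P → x∈p─q⇒x∉q Y P y∈Y─P y∈P) , y∉U ] ∘ x∈p∪q⁻ (Y ─ P) U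

  modular-pair-elimination : ∀ {C′} → IsCircuit M C → IsCircuit M D → IsCircuit M C′ →
    ∣ C ∪ D ∣ ≡ r (C ∪ D) + 2 → e ∈ D → C′ ⊆ (C ∪ D) - e →
    ∣ D ∪ C′ ∣ ≡ r (D ∪ C′) + 2 × C ⊆ D ∪ C′
  modular-pair-elimination {C} {D} {e} {C′} isC isD isC′ modular e∈D C′⊆W-e =
    U-modular , C⊆U
    where
    W U : Subset n
    W = C ∪ D
    U = D ∪ C′
    U⊆W : U ⊆ W
    U⊆W = ∪-lub (q⊆p∪q C D) (p-x⊆p W ∘ C′⊆W-e)
    U-modular : ∣ U ∣ ≡ r U + 2
    U-modular = ≤-antisym
      (+-cancelˡ-≤ (r W) _ _ (begin
        r W + ∣ U ∣      ≤⟨ nullity-mono U⊆W ⟩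
        r U + ∣ W ∣      ≡⟨ cong (r U +_) modular ⟩
        r U + (r W + 2)  ≡⟨ x∙yz≈y∙xz (r U) (r W) 2 ⟩
        r W + (r U + 2)  ∎))
      (distinct-circuits-nullity isD isC′ λ D≡C′ → x∉p-x W (C′⊆W-e (subst (e ∈_) D≡C′ e∈D)))
      where open ≤-Reasoning
    C⊆U : C ⊆ U
    C⊆U {x} x∈C with x ∈? U
    ... | yes x∈U = x∈U
    ... | no  x∉U = contradiction (+-cancelˡ-≤ (r U) _ _ (begin
        r U + suc ∣ W - x ∣    ≡⟨ cong (r U +_) (x∈p⇒1+∣p-x∣≡∣p∣ x∈W) ⟩
        r U + ∣ W ∣            ≡⟨ cong (r U +_) modular ⟩
        r U + (r W + 2)        ≡⟨ x∙yz≈y∙xz (r U) (r W) 2 ⟩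
        r W + (r U + 2)        ≡⟨ cong₂ _+_ (circuit-rank-delete isC (p⊆p∪q D) x∈C) U-modular ⟨
        r (W - x) + ∣ U ∣      ≤⟨ nullity-mono (p⊆q∧x∉p⇒p⊆q-x U⊆W x∉U) ⟩
        r U + ∣ W - x ∣        ∎)) 1+n≰n
      where
      open ≤-Reasoning
      x∈W : x ∈ W
      x∈W = p⊆p∪q D x∈C

  minus-two-dependent : ∀ {W e g} → r W + 2 < ∣ W ∣ → e ∈ W → g ∈ W - e → Dependent M ((W - e) - g)
  minus-two-dependent {W} {e} {g} nullity>2 e∈W g∈W-e = ≤-pred (≤-pred (begin
    suc (suc (suc (r ((W - e) - g))))  ≤⟨ s≤s (s≤s (s≤s (rank-mono M (p-x⊆p W ∘ p-x⊆p (W - e))))) ⟩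
    suc (suc (suc (r W)))              ≡⟨ cong suc (+-comm 2 (r W)) ⟩
    suc (r W + 2)                      ≤⟨ nullity>2 ⟩
    ∣ W ∣                              ≡⟨ x∈p⇒1+∣p-x∣≡∣p∣ e∈W ⟨
    suc ∣ W - e ∣                      ≡⟨ cong suc (x∈p⇒1+∣p-x∣≡∣p∣ g∈W-e) ⟨
    suc (suc ∣ (W - e) - g ∣)          ∎))
    where open ≤-Reasoning

  -- Without such h, every h ∈ C ∖ D would be a coloop of Y = C ∪ D - e - g (which spans e
  -- through C - e), making Y independent; yet Y still has positive nullity.
  nonmodular-has-exchange : ∀ {g} → IsCircuit M C → IsCircuit M D → e ∈ C → e ∈ D → g ∈ D → g ∉ C →
    r (C ∪ D) + 2 < ∣ C ∪ D ∣ →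
    ¬ (∀ {h} → h ∈ C → h ∉ D → ¬ (e ∈cl M) ((((C ∪ D) - e) - g) - h))
  nonmodular-has-exchange {C} {D} {e} {g} isC isD e∈C e∈D g∈D g∉C nonmodular no-exchange =
    <⇒≱ Y-dependent Y-independent
    where
    W Y P : Subset n
    W = C ∪ D
    Y = (W - e) - g
    P = C ─ D

    in-Y : ∀ {x} → x ∈ W → x ≢ e → x ≢ g → x ∈ Y
    in-Y x∈W x≢e x≢g = x∈p∧x≢y⇒x∈p-y (x∈p∧x≢y⇒x∈p-y x∈W x≢e) x≢g

    e∈clY : (e ∈cl M) Y
    e∈clY = ∈cl-mono C-e⊆Y (circuit-∈cl isC e∈C)
      where
      C-e⊆Y : C - e ⊆ Y
      C-e⊆Y x∈C-e = in-Y (p⊆p∪q D (p-x⊆p C x∈C-e)) (x∈p-y⇒x≢y C x∈C-e) λ { refl → g∉C (p-x⊆p C x∈C-e) }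

    P⊆Y : P ⊆ Y
    P⊆Y x∈P = in-Y (p⊆p∪q D (p─q⊆p C D x∈P)) (λ { refl → x∉D e∈D }) (λ { refl → x∉D g∈D })
      where x∉D = x∈p─q⇒x∉q C D x∈P

    coloops : ∀ {h} → h ∈ P → r (Y - h) < r Y
    coloops h∈P = ≤∧≢⇒< (rank-mono M (p-x⊆p Y)) λ r[Y-h]≡rY →
      no-exchange (p─q⊆p C D h∈P) (x∈p─q⇒x∉q C D h∈P) (∈cl-of-≡-rank (p-x⊆p Y) r[Y-h]≡rY e∈clY)

    Y─P⊆D-e : Y ─ P ⊆ D - e
    Y─P⊆D-e {x} x∈Y─P with x ∈? D
    ... | yes x∈D = x∈p∧x≢y⇒x∈p-y x∈D (x∈p-y⇒x≢y W (p-x⊆p (W - e) x∈Y))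
      where x∈Y = p─q⊆p Y P x∈Y─P
    ... | no  x∉D = absurd (x∈p─q⇒x∉q Y P x∈Y─P (x∈p∧x∉q⇒x∈p─q x∈C x∉D))
      where x∈C = x∈p∪q∧x∉q⇒x∈p (p-x⊆p W (p-x⊆p (W - e) (p─q⊆p Y P x∈Y─P))) x∉D

    Y-independent : Independent M Y
    Y-independent = independent-by-coloops P⊆Y coloops
      (independent-⊆ Y─P⊆D-e (circuit-minus-independent isD e∈D))

    Y-dependent : Dependent M Y
    Y-dependent = minus-two-dependent nonmodular (p⊆p∪q D e∈C)
      (x∈p∧x≢y⇒x∈p-y (q⊆p∪q C D g∈D) λ { refl → g∉C e∈C })

  nonmodular-exchange : ∀ {g} → IsCircuit M C → IsCircuit M D → e ∈ C → e ∈ D → g ∈ D → g ∉ C →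
    r (C ∪ D) + 2 < ∣ C ∪ D ∣ →
    ∃[ h ] h ∈ C × h ∉ D × ∃[ D′ ] IsCircuit M D′ × e ∈ D′ × D′ ⊆ C ∪ D × g ∉ D′ × h ∉ D′
  nonmodular-exchange {C} {D} {e} {g} isC isD e∈C e∈D g∈D g∉C nonmodular
    with any? (λ h → (h ∈? C) ×-dec ¬? (h ∈? D) ×-dec (e ∈cl? ((((C ∪ D) - e) - g) - h)))
  ... | no  none = absurd (nonmodular-has-exchange isC isD e∈C e∈D g∈D g∉C nonmodular
                             λ h∈C h∉D e∈cl → none (_ , h∈C , h∉D , e∈cl))
  ... | yes (h , h∈C , h∉D , e∈cl) =
    let D′ , D′⊆ , isD′ , e∈D′ = ∈cl⇒circuit e∉ e∈cl
    in  h , h∈C , h∉D , D′ , isD′ , e∈D′ , proj₁ ∘ in-D′ ∘ D′⊆ ,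
        (λ g∈D′ → proj₁ (proj₂ (in-D′ (D′⊆ g∈D′))) refl) , (λ h∈D′ → proj₂ (proj₂ (in-D′ (D′⊆ h∈D′))) refl)
    where
    V : Subset n
    V = (((C ∪ D) - e) - g) - h
    e∉ : e ∉ V
    e∉ e∈V = x∉p-x (C ∪ D) (p-x⊆p _ (p-x⊆p _ e∈V))
    in-D′ : ∀ {x} → x ∈ V ∪ ⁅ e ⁆ → x ∈ C ∪ D × x ≢ g × x ≢ h
    in-D′ x∈ with x∈p∪q⁻ V ⁅ e ⁆ x∈
    ... | inj₁ x∈V   = p-x⊆p _ (p-x⊆p _ (p-x⊆p _ x∈V)) ,
                       x∈p-y⇒x≢y _ (p-x⊆p _ x∈V) , x∈p-y⇒x≢y _ x∈V
    ... | inj₂ x∈⁅e⁆ with refl ← x∈⁅y⁆⇒x≡y e x∈⁅e⁆ =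
      p⊆p∪q D e∈C , (λ { refl → g∉C e∈C }) , (λ { refl → h∉D e∈D })

-- Linear subclasses of circuits

module EnumeratedCircuits {n m} (M : Matroid n) (ce : CircuitEnum M m) where

  open MatroidProperties M

  private
    c : Fin m → Subset n
    c = circ ce

    r : Subset n → ℕ
    r = rank M

  IsLinearSubclass : (Fin m → Set) → Set
  IsLinearSubclass 𝒮 = ∀ i₁ i₂ → ∣ c i₁ ∪ c i₂ ∣ ≡ r (c i₁ ∪ c i₂) + 2 → 𝒮 i₁ → 𝒮 i₂ →
    ∀ j → c j ⊆ c i₁ ∪ c i₂ → 𝒮 j

  circuit-index-in : ∀ {X} → Dependent M X → ∃[ i ] c i ⊆ X
  circuit-index-in {X} depX with dependent⇒circuit depX
  ... | C , C⊆X , isC with circ-onto ce C isC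
  ...   | i , refl = i , C⊆X

  circuit-index-through : ∀ {e X} → e ∉ X → (e ∈cl M) X → ∃[ d ] c d ⊆ X ∪ ⁅ e ⁆ × e ∈ c d
  circuit-index-through e∉X e∈clX with ∈cl⇒circuit e∉X e∈clX
  ... | C , C⊆X∪e , isC , e∈C with circ-onto ce C isC
  ...   | d , refl = d , C⊆X∪e , e∈C

  ∈-circuitsIn⁺ : ∀ {j X} → c j ⊆ X → j ∈ circuitsIn ce X
  ∈-circuitsIn⁺ {j} {X} cj⊆X = lookup⇒[]= j (circuitsIn ce X)
    (trans (lookup∘tabulate _ j) (dec-true (c j ⊆? X) cj⊆X))

  ∈-circuitsIn⁻ : ∀ {j X} → j ∈ circuitsIn ce X → c j ⊆ X
  ∈-circuitsIn⁻ {j} {X} j∈ with c j ⊆? X | trans (sym ([]=⇒lookup j∈)) (lookup∘tabulate _ j)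
  ... | yes cj⊆X | _ = cj⊆X

  circuitsIn-mono : ∀ {X Y} → X ⊆ Y → circuitsIn ce X ⊆ circuitsIn ce Y
  circuitsIn-mono X⊆Y j∈ = ∈-circuitsIn⁺ (X⊆Y ∘ ∈-circuitsIn⁻ j∈)

  circuitsIn-⊥ : circuitsIn ce ⊥ ≡ ⊥
  circuitsIn-⊥ = Empty-unique λ (j , j∈) →
    let x , x∈cj = circuit-nonempty (circ-isC ce j) in ∉⊥ (∈-circuitsIn⁻ j∈ x∈cj)

  circuitsIn-⊤ : circuitsIn ce ⊤ ≡ ⊤
  circuitsIn-⊤ = ⊆-antisym ⊆⊤ λ _ → ∈-circuitsIn⁺ ⊆⊤

  circuitsIn-∪-∉cl : ∀ {e X} → ¬ (e ∈cl M) X → circuitsIn ce (X ∪ ⁅ e ⁆) ≡ circuitsIn ce X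
  circuitsIn-∪-∉cl {e} {X} e∉clX =
    ⊆-antisym (λ j∈ → ∈-circuitsIn⁺ (cj⊆X _ (∈-circuitsIn⁻ j∈))) (circuitsIn-mono (p⊆p∪q _))
    where
    cj⊆X : ∀ j → c j ⊆ X ∪ ⁅ e ⁆ → c j ⊆ X
    cj⊆X j cj⊆ with e ∈? c j
    ... | yes e∈cj = contradiction
      (∈cl-mono (λ x∈ → x∈p∪q∧x∉q⇒x∈p (cj⊆ (p-x⊆p (c j) x∈)) (x≢y⇒x∉⁅y⁆ (x∈p-y⇒x≢y (c j) x∈)))
                (circuit-∈cl (circ-isC ce j) e∈cj)) e∉clX
    ... | no  e∉cj = λ x∈cj → x∈p∪q∧x∉q⇒x∈p (cj⊆ x∈cj)
                                 λ x∈⁅e⁆ → e∉cj (subst (_∈ c j) (x∈⁅y⁆⇒x≡y e x∈⁅e⁆) x∈cj)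

  closures-linear : (N : Matroid m) →
    (∀ i₁ i₂ → ∣ c i₁ ∪ c i₂ ∣ ≡ r (c i₁ ∪ c i₂) + 2 → ∀ j → c j ⊆ c i₁ ∪ c i₂ → (j ∈cl N) (⁅ i₁ ⁆ ∪ ⁅ i₂ ⁆)) →
    ∀ T → IsLinearSubclass (λ j → (j ∈cl N) T)
  closures-linear N pair-closure T i₁ i₂ modular i₁∈clT i₂∈clT j cj⊆ =
    MatroidProperties.∈cl-trans N pair-spanned (pair-closure i₁ i₂ modular j cj⊆)
    where
    pair-spanned : ∀ {i} → i ∈ ⁅ i₁ ⁆ ∪ ⁅ i₂ ⁆ → (i ∈cl N) T
    pair-spanned i∈ with x∈p∪q⁻ ⁅ i₁ ⁆ ⁅ i₂ ⁆ i∈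
    ... | inj₁ i∈⁅i₁⁆ rewrite x∈⁅y⁆⇒x≡y i₁ i∈⁅i₁⁆ = i₁∈clT
    ... | inj₂ i∈⁅i₂⁆ rewrite x∈⁅y⁆⇒x≡y i₂ i∈⁅i₂⁆ = i₂∈clT

  module _ {𝒮 : Fin m → Set} (linear : IsLinearSubclass 𝒮) where

    SpreadsOver : Subset n → Set
    SpreadsOver Z = ∀ {e} → (∀ i → c i ⊆ Z → e ∉ c i → 𝒮 i) →
      ∀ {d} → c d ⊆ Z → e ∈ c d → 𝒮 d → ∀ j → c j ⊆ Z → 𝒮 j

    modular-step : ∀ {Z e d j} → (∀ i → c i ⊆ Z → e ∉ c i → 𝒮 i) → c d ⊆ Z → e ∈ c d → 𝒮 d →
      c j ⊆ Z → e ∈ c j → c j ≢ c d → ∣ c j ∪ c d ∣ ≡ r (c j ∪ c d) + 2 → 𝒮 j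
    modular-step {Z} {e} {d} {j} avoiding d⊆Z e∈d 𝒮d j⊆Z e∈j cj≢cd modular =
      let k , k⊆W-e  = circuit-index-in (weak-circuit-elimination isj isd cj≢cd e∈j)
          modular′ , cj⊆ = modular-pair-elimination isj isd (circ-isC ce k) modular e∈d k⊆W-e
          𝒮k = avoiding k (∪-lub j⊆Z d⊆Z ∘ p-x⊆p _ ∘ k⊆W-e) (x∉p-x _ ∘ k⊆W-e)
      in  linear d k modular′ 𝒮d 𝒮k j cj⊆
      where
      isj = circ-isC ce j
      isd = circ-isC ce d

    -- D′ carries 𝒮 from d to d′ inside c d ∪ D′ ⊆ Z - h, and then from d′ to j inside
    -- c j ∪ D′ ⊆ Z - g.
    nonmodular-step : ∀ {Z} → (∀ {Z′} → Z′ ⊂ Z → SpreadsOver Z′) →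
      ∀ {e d j} → (∀ i → c i ⊆ Z → e ∉ c i → 𝒮 i) → c d ⊆ Z → e ∈ c d → 𝒮 d →
      c j ⊆ Z → e ∈ c j → c j ≢ c d → r (c j ∪ c d) + 2 < ∣ c j ∪ c d ∣ → 𝒮 j
    nonmodular-step {Z} spreads {e} {d} {j} avoiding d⊆Z e∈d 𝒮d j⊆Z e∈j cj≢cd nonmodular
      with p⊈q⇒∃∉ (λ cd⊆cj → cj≢cd (sym (proj₂ (circ-isC ce j) (c d) cd⊆cj (proj₁ (circ-isC ce d)))))
    ... | g , g∈d , g∉j
      with nonmodular-exchange (circ-isC ce j) (circ-isC ce d) e∈j e∈d g∈d g∉j nonmodular
    ... | h , h∈j , h∉d , D′ , isD′ , e∈D′ , D′⊆ , g∉D′ , h∉D′ with circ-onto ce D′ isD′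
    ... | d′ , refl = spreads cj∪d′⊂Z (restrict (proj₁ cj∪d′⊂Z)) (q⊆p∪q (c j) _) e∈D′ 𝒮d′ j (p⊆p∪q _)
      where
      d′⊆Z : c d′ ⊆ Z
      d′⊆Z = ∪-lub j⊆Z d⊆Z ∘ D′⊆
      restrict : ∀ {Z′} → Z′ ⊆ Z → ∀ i → c i ⊆ Z′ → e ∉ c i → 𝒮 i
      restrict Z′⊆Z i i⊆Z′ = avoiding i (Z′⊆Z ∘ i⊆Z′)
      cd∪d′⊂Z : c d ∪ c d′ ⊂ Z
      cd∪d′⊂Z = p⊆s∧q⊆s⇒p∪q⊂s d⊆Z d′⊆Z (j⊆Z h∈j) h∉d h∉D′
      cj∪d′⊂Z : c j ∪ c d′ ⊂ Z
      cj∪d′⊂Z = p⊆s∧q⊆s⇒p∪q⊂s j⊆Z d′⊆Z (d⊆Z g∈d) g∉j g∉D′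
      𝒮d′ : 𝒮 d′
      𝒮d′ = spreads cd∪d′⊂Z (restrict (proj₁ cd∪d′⊂Z)) (p⊆p∪q _) e∈d 𝒮d d′ (q⊆p∪q (c d) _)

    spreads-over : ∀ Z → SpreadsOver Z
    spreads-over Z = go (⊂-wellFounded Z)
      where
      go : ∀ {Z} → Acc _⊂_ Z → SpreadsOver Z
      go (acc smaller) {e} avoiding {d} d⊆Z e∈d 𝒮d j j⊆Z with e ∈? c j | j ≟ᶠ d
      ... | no  e∉j | _        = avoiding j j⊆Z e∉j
      ... | yes _   | yes refl = 𝒮d
      ... | yes e∈j | no  j≢d  with ∣ c j ∪ c d ∣ ≟ℕ r (c j ∪ c d) + 2
      ...   | yes modular    = modular-step avoiding d⊆Z e∈d 𝒮d j⊆Z e∈j cj≢cd modular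
        where cj≢cd = j≢d ∘ circ-inj ce j d
      ...   | no  ¬modular   = nonmodular-step (go ∘ smaller) avoiding d⊆Z e∈d 𝒮d j⊆Z e∈j cj≢cd
        (≤∧≢⇒< (distinct-circuits-nullity (circ-isC ce j) (circ-isC ce d) cj≢cd) (¬modular ∘ sym))
        where cj≢cd = j≢d ∘ circ-inj ce j d

-- The rank function r_M + ρ

module LiftRank {n m} (M : Matroid n) (ce : CircuitEnum M m) (N : Matroid m)
  (closure-linear : ∀ T → EnumeratedCircuits.IsLinearSubclass M ce (λ j → (j ∈cl N) T)) where

  open MatroidProperties M
  open EnumeratedCircuits M ce
  private
    module N = MatroidProperties N

    c : Fin m → Subset n
    c = circ ce

    r : Subset n → ℕ
    r = rank M

  ρ : Subset n → ℕ
  ρ X = rank N (circuitsIn ce X)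

  ρ-mono : ∀ {X Y} → X ⊆ Y → ρ X ≤ ρ Y
  ρ-mono X⊆Y = rank-mono N (circuitsIn-mono X⊆Y)

  ρ-∪-circuit : ∀ {e B d} → c d ⊆ B ∪ ⁅ e ⁆ → e ∈ c d → ρ (B ∪ ⁅ e ⁆) ≤ rank N (circuitsIn ce B ∪ ⁅ d ⁆)
  ρ-∪-circuit {e} {B} {d} cd⊆ e∈cd = begin
    ρ (B ∪ ⁅ e ⁆)                          ≤⟨ rank-mono N (q⊆p∪q T _) ⟩
    rank N (T ∪ circuitsIn ce (B ∪ ⁅ e ⁆))  ≡⟨ N.rank-∪-spanned (spanned _ ∘ ∈-circuitsIn⁻) ⟩
    rank N T                                ∎
    where
    open ≤-Reasoning
    T : Subset m
    T = circuitsIn ce B ∪ ⁅ d ⁆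
    avoiding : ∀ j → c j ⊆ B ∪ ⁅ e ⁆ → e ∉ c j → (j ∈cl N) T
    avoiding j cj⊆ e∉cj = N.∈cl-∈ (p⊆p∪q _ (∈-circuitsIn⁺ λ x∈cj → x∈p∪q∧x∉q⇒x∈p (cj⊆ x∈cj)
      λ x∈⁅e⁆ → e∉cj (subst (_∈ c j) (x∈⁅y⁆⇒x≡y e x∈⁅e⁆) x∈cj)))
    spanned : ∀ j → c j ⊆ B ∪ ⁅ e ⁆ → (j ∈cl N) T
    spanned = spreads-over (closure-linear T) (B ∪ ⁅ e ⁆) avoiding cd⊆ e∈cd (N.∈cl-∈ (q⊆p∪q _ _ (x∈⁅x⁆ d)))

  ρ-insert-≤ : ∀ {e B} → (e ∈cl M) B → ρ (B ∪ ⁅ e ⁆) ≤ suc (ρ B)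
  ρ-insert-≤ {e} {B} e∈clB with e ∈? B
  ... | yes e∈B = ≤-trans (≤-reflexive (cong ρ (x∈p⇒p∪⁅x⁆≡p e∈B))) (n≤1+n _)
  ... | no  e∉B = let d , cd⊆ , e∈cd = circuit-index-through e∉B e∈clB
                  in  ≤-trans (ρ-∪-circuit cd⊆ e∈cd) (N.rank-insert-≤ _ d)

  ρ-diminishing-returns-∈cl : ∀ {e A B} → (e ∈cl M) A → A ⊆ B →
    ρ (B ∪ ⁅ e ⁆) + ρ A ≤ ρ (A ∪ ⁅ e ⁆) + ρ B
  ρ-diminishing-returns-∈cl {e} {A} {B} e∈clA A⊆B with e ∈? A
  ... | yes e∈A = ≤-reflexive (begin
    ρ (B ∪ ⁅ e ⁆) + ρ A  ≡⟨ cong₂ _+_ (cong ρ (x∈p⇒p∪⁅x⁆≡p (A⊆B e∈A))) (cong ρ (sym (x∈p⇒p∪⁅x⁆≡p e∈A))) ⟩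
    ρ B + ρ (A ∪ ⁅ e ⁆)  ≡⟨ +-comm (ρ B) _ ⟩
    ρ (A ∪ ⁅ e ⁆) + ρ B  ∎)
    where open ≡-Reasoning
  ... | no  e∉A with circuit-index-through e∉A e∈clA
  ...   | d , cd⊆A∪e , e∈cd = begin
    ρ (B ∪ ⁅ e ⁆) + ρ A                     ≤⟨ +-monoˡ-≤ (ρ A) (ρ-∪-circuit (∪-monoˡ A⊆B ∘ cd⊆A∪e) e∈cd) ⟩
    rank N (circuitsIn ce B ∪ ⁅ d ⁆) + ρ A  ≤⟨ N.rank-diminishing-returns d (circuitsIn-mono A⊆B) ⟩
    rank N (circuitsIn ce A ∪ ⁅ d ⁆) + ρ B  ≤⟨ +-monoˡ-≤ (ρ B) (rank-mono N new-circuit) ⟩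
    ρ (A ∪ ⁅ e ⁆) + ρ B                     ∎
    where
    open ≤-Reasoning
    new-circuit : circuitsIn ce A ∪ ⁅ d ⁆ ⊆ circuitsIn ce (A ∪ ⁅ e ⁆)
    new-circuit = ∪-lub (circuitsIn-mono (p⊆p∪q _)) (x∈p⇒⁅x⁆⊆p (∈-circuitsIn⁺ cd⊆A∪e))

  rank-L : Subset n → ℕ
  rank-L X = r X + ρ X

  rank-L-insert-≤ : ∀ X x → rank-L (X ∪ ⁅ x ⁆) ≤ suc (rank-L X)
  rank-L-insert-≤ X x with x ∈cl? X
  ... | yes x∈clX = ≤-trans (+-mono-≤ (≤-reflexive x∈clX) (ρ-insert-≤ x∈clX)) (≤-reflexive (+-suc (r X) (ρ X)))
  ... | no  x∉clX = +-mono-≤ (rank-insert-≤ X x) (≤-reflexive (cong (rank N) (circuitsIn-∪-∉cl x∉clX)))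

  rank-L-diminishing-returns : DiminishingReturns rank-L
  rank-L-diminishing-returns {A} {B} e A⊆B = begin
    rank-L (B ∪ ⁅ e ⁆) + rank-L A                      ≡⟨ interchange (r (B ∪ ⁅ e ⁆)) _ _ _ ⟩
    (r (B ∪ ⁅ e ⁆) + r A) + (ρ (B ∪ ⁅ e ⁆) + ρ A)    ≤⟨ by-cases ⟩
    (r (A ∪ ⁅ e ⁆) + r B) + (ρ (A ∪ ⁅ e ⁆) + ρ B)    ≡⟨ interchange (r (A ∪ ⁅ e ⁆)) _ _ _ ⟩
    rank-L (A ∪ ⁅ e ⁆) + rank-L B                      ∎
    where
    open ≤-Reasoning
    by-cases : (r (B ∪ ⁅ e ⁆) + r A) + (ρ (B ∪ ⁅ e ⁆) + ρ A) ≤ (r (A ∪ ⁅ e ⁆) + r B) + (ρ (A ∪ ⁅ e ⁆) + ρ B)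
    by-cases with e ∈cl? A
    ... | yes e∈clA = +-mono-≤ (rank-diminishing-returns e A⊆B) (ρ-diminishing-returns-∈cl e∈clA A⊆B)
    ... | no  e∉clA with e ∈cl? B
    ...   | no  e∉clB = +-mono-≤ (rank-diminishing-returns e A⊆B) (begin
      ρ (B ∪ ⁅ e ⁆) + ρ A  ≡⟨ cong (_+ ρ A) (cong (rank N) (circuitsIn-∪-∉cl e∉clB)) ⟩
      ρ B + ρ A            ≤⟨ +-monoʳ-≤ (ρ B) (ρ-mono (p⊆p∪q _)) ⟩
      ρ B + ρ (A ∪ ⁅ e ⁆)  ≡⟨ +-comm (ρ B) _ ⟩
      ρ (A ∪ ⁅ e ⁆) + ρ B  ∎)
    ...   | yes e∈clB = +-≤-slack {k = 1} (begin
      r (B ∪ ⁅ e ⁆) + r A + 1  ≡⟨ cong (λ x → x + r A + 1) e∈clB ⟩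
      r B + r A + 1            ≡⟨ one-more (r B) (r A) ⟩
      suc (r A) + r B          ≡⟨ cong (_+ r B) (∉cl⇒rank-insert≡1+ e∉clA) ⟨
      r (A ∪ ⁅ e ⁆) + r B      ∎) (begin
      ρ (B ∪ ⁅ e ⁆) + ρ A      ≤⟨ +-mono-≤ (ρ-insert-≤ e∈clB) (ρ-mono (p⊆p∪q _)) ⟩
      suc (ρ B) + ρ (A ∪ ⁅ e ⁆) ≡⟨ one-more (ρ (A ∪ ⁅ e ⁆)) (ρ B) ⟨
      ρ (A ∪ ⁅ e ⁆) + ρ B + 1   ∎)
      where
      one-more : ∀ a b → a + b + 1 ≡ suc b + a
      one-more = solve-∀

  rank-L-⊥ : rank-L ⊥ ≡ 0
  rank-L-⊥ = cong₂ _+_ rank-⊥ (trans (cong (rank N) circuitsIn-⊥) N.rank-⊥)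

  L : Matroid n
  L = record
    { rank        = rank-L
    ; rank-≤-card = unit-increase⇒≤∣∣ rank-L rank-L-⊥ rank-L-insert-≤
    ; rank-mono   = λ X⊆Y → +-mono-≤ (rank-mono M X⊆Y) (ρ-mono X⊆Y)
    ; rank-submod = diminishing-returns⇒submodular rank-L rank-L-diminishing-returns
    }

  rank-L-defect-mono : ∀ {X Y} → X ⊆ Y → rank-L X + r Y ≤ rank-L Y + r X
  rank-L-defect-mono {X} {Y} X⊆Y = begin
    r X + ρ X + r Y  ≡⟨ xy∙z≈xz∙y (r X) (ρ X) (r Y) ⟩
    r X + r Y + ρ X  ≤⟨ +-monoʳ-≤ (r X + r Y) (ρ-mono X⊆Y) ⟩
    r X + r Y + ρ Y  ≡⟨ cong (_+ ρ Y) (+-comm (r X) (r Y)) ⟩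
    r Y + r X + ρ Y  ≡⟨ xy∙z≈xz∙y (r Y) (r X) (ρ Y) ⟩
    r Y + ρ Y + r X  ∎
    where open ≤-Reasoning

  rank-L-≤ : ∀ X → rank-L X ≤ r X + rank N ⊤
  rank-L-≤ X = +-monoʳ-≤ (r X) (rank-mono N ⊆⊤)

  rank-L-⊤ : rank-L ⊤ ≡ r ⊤ + rank N ⊤
  rank-L-⊤ = cong (λ C → r ⊤ + rank N C) circuitsIn-⊤

-- Lifts

module MonotoneDefectLift {n} (L M : Matroid n) (k : ℕ)
  (defect-mono : ∀ {X Y} → X ⊆ Y → rank L X + rank M Y ≤ rank L Y + rank M X)
  (defect-≤ : ∀ X → rank L X ≤ rank M X + k) where

  private
    module L = MatroidProperties L
    module M = MatroidProperties M

  -- E and F are the first n and the last k coordinates.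
  rank-Kˡ rank-Kʳ rank-K : Subset (n + k) → ℕ
  rank-Kˡ S = rank L (take n S) + ∣ drop n S ∣
  rank-Kʳ S = rank M (take n S) + k
  rank-K S = rank-Kˡ S ⊓ rank-Kʳ S

  rank-K-++ : ∀ X Y → rank-K (X ++ Y) ≡ (rank L X + ∣ Y ∣) ⊓ (rank M X + k)
  rank-K-++ X Y = cong₂ (λ X′ Y′ → (rank L X′ + ∣ Y′ ∣) ⊓ (rank M X′ + k)) (take-++ X Y) (drop-++ X Y)

  M≤L : ∀ X → rank M X ≤ rank L X
  M≤L X = subst₂ _≤_ (cong (_+ rank M X) L.rank-⊥)
                     (trans (cong (rank L X +_) M.rank-⊥) (+-identityʳ _))
                     (defect-mono {⊥} {X} (⊆-min X))

  crossing : ∀ {S T} → S ⊆ T → rank-Kˡ S + rank-Kʳ T ≤ rank-Kˡ T + rank-Kʳ S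
  crossing {S} {T} S⊆T = begin
    (rank L X + ∣ Y ∣) + (rank M X′ + k)  ≡⟨ interchange (rank L X) _ _ _ ⟩
    (rank L X + rank M X′) + (∣ Y ∣ + k)  ≤⟨ +-mono-≤ (defect-mono (take-⊆ n {k} S⊆T))
                                                      (+-monoˡ-≤ k (p⊆q⇒∣p∣≤∣q∣ (drop-⊆ n {k} S⊆T))) ⟩
    (rank L X′ + rank M X) + (∣ Y′ ∣ + k) ≡⟨ interchange (rank L X′) _ _ _ ⟩
    (rank L X′ + ∣ Y′ ∣) + (rank M X + k) ∎
    where
    open ≤-Reasoning
    X X′ : Subset n
    X = take n S
    X′ = take n T
    Y Y′ : Subset k
    Y = drop n S
    Y′ = drop n T

  K : Matroid (n + k)
  K = record
    { rank        = rank-K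
    ; rank-≤-card = λ S → ≤-trans (m⊓n≤m _ _)
        (≤-trans (+-monoˡ-≤ _ (rank-≤-card L (take n S))) (≤-reflexive (sym (∣p∣≡∣take∣+∣drop∣ n S))))
    ; rank-mono   = λ S⊆T → ⊓-mono-≤
        (+-mono-≤ (rank-mono L (take-⊆ n {k} S⊆T)) (p⊆q⇒∣p∣≤∣q∣ (drop-⊆ n {k} S⊆T)))
        (+-monoˡ-≤ k (rank-mono M (take-⊆ n {k} S⊆T)))
    ; rank-submod = ⊓-submodular {f = rank-Kˡ} {g = rank-Kʳ} rank-Kˡ-submodular rank-Kʳ-submodular crossing
    }
    where
    rank-Kˡ-submodular : Submodular rank-Kˡ
    rank-Kˡ-submodular = +-submodular {f = λ S → rank L (take n S)} {g = λ S → ∣ drop n S ∣}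
      (take-submodular n {k} {rank L} (rank-submod L)) (drop-submodular n {k} {∣_∣} ∣∣-submodular)
    rank-Kʳ-submodular : Submodular rank-Kʳ
    rank-Kʳ-submodular = +-submodular {f = λ S → rank M (take n S)} {g = λ _ → k}
      (take-submodular n {k} {rank M} (rank-submod M)) (λ _ _ → ≤-refl)

  rank-K-E : ∀ X → rank-K (embedE k X) ≡ rank L X
  rank-K-E X = begin
    rank-K (X ++ ⊥)                          ≡⟨ rank-K-++ X ⊥ ⟩
    (rank L X + ∣ ⊥ {k} ∣) ⊓ (rank M X + k)  ≡⟨ cong (λ z → (rank L X + z) ⊓ (rank M X + k)) (∣⊥∣≡0 k) ⟩
    (rank L X + 0) ⊓ (rank M X + k)          ≡⟨ cong (_⊓ (rank M X + k)) (+-identityʳ _) ⟩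
    rank L X ⊓ (rank M X + k)                ≡⟨ m≤n⇒m⊓n≡m (defect-≤ X) ⟩
    rank L X                                 ∎
    where open ≡-Reasoning

  rank-K-E∪F : ∀ X → rank-K (embedE k X ∪ setF n k) ≡ rank M X + k
  rank-K-E∪F X = begin
    rank-K ((X ++ ⊥) ∪ (⊥ {n} ++ ⊤))         ≡⟨ cong rank-K (zipWith-++ _∨_ X (⊥ {k}) ⊥ (⊤ {k})) ⟩
    rank-K ((X ∪ ⊥) ++ (⊥ ∪ ⊤ {k}))          ≡⟨ cong₂ (λ X′ Y′ → rank-K (X′ ++ Y′)) (∪-identityʳ X) (∪-identityˡ ⊤) ⟩
    rank-K (X ++ ⊤)                          ≡⟨ rank-K-++ X ⊤ ⟩
    (rank L X + ∣ ⊤ {k} ∣) ⊓ (rank M X + k)  ≡⟨ cong (λ z → (rank L X + z) ⊓ (rank M X + k)) (∣⊤∣≡n k) ⟩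
    (rank L X + k) ⊓ (rank M X + k)          ≡⟨ m≥n⇒m⊓n≡n (+-monoˡ-≤ k (M≤L X)) ⟩
    rank M X + k                             ∎
    where open ≡-Reasoning

  rank-K-F : rank-K (setF n k) ≡ k
  rank-K-F = begin
    rank-K (⊥ ++ ⊤ {k})                      ≡⟨ rank-K-++ ⊥ ⊤ ⟩
    (rank L ⊥ + ∣ ⊤ {k} ∣) ⊓ (rank M ⊥ + k)  ≡⟨ cong₂ (λ a b → (a + ∣ ⊤ {k} ∣) ⊓ (b + k)) L.rank-⊥ M.rank-⊥ ⟩
    ∣ ⊤ {k} ∣ ⊓ k                            ≡⟨ cong (_⊓ k) (∣⊤∣≡n k) ⟩
    k ⊓ k                                    ≡⟨ ⊓-idem k ⟩
    k                                        ∎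
    where open ≡-Reasoning

  isLift : IsLift L M
  isLift = k , K , (λ X → sym (trans (cong₂ _∸_ (rank-K-E∪F X) rank-K-F) (m+n∸n≡m (rank M X) k)))
                 , (λ X → sym (rank-K-E X))

theorem1p2 : ∀ {n m} (M : Matroid n) (ce : CircuitEnum M m) (N : Matroid m) →
    (∀ i₁ i₂ → ∣ circ ce i₁ ∪ circ ce i₂ ∣ ≡ rank M (circ ce i₁ ∪ circ ce i₂) + 2 →
      ∀ j → circ ce j ⊆ circ ce i₁ ∪ circ ce i₂ → (j ∈cl N) (⁅ i₁ ⁆ ∪ ⁅ i₂ ⁆)) →
    Σ (Matroid n) λ L →
      (∀ X → rank L X ≡ rank M X + rank N (circuitsIn ce X))
      × IsRankLift (totalRank N) L M
theorem1p2 M ce N pair-closure = L , (λ _ → refl) , isLift , rank-L-⊤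
  where
  open LiftRank M ce N (EnumeratedCircuits.closures-linear M ce N pair-closure)
  open MonotoneDefectLift L M (rank N ⊤) rank-L-defect-mono rank-L-≤
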